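{- Let $\Pi$ be the partial map on $\mathbb{N}=\{1,2,3,\dots\}$ produced by the following procedure. At step $1$ set $\Pi(1)=1$. For $m=2,3,4,\dots$ in turn, at step $m$: if $\Pi(m-\lfloor m/2\rfloor)$ has not been assigned at an earlier step, set $\Pi(m-\lfloor m/2\rfloor)=m$; otherwise set $\Pi(m+\lfloor m/2\rfloor)=m$. Then for every $n\ge 1$, when the procedure arrives at step $2n$ (i.e. after steps $1,\dots,2n-1$ have been carried out), each of the numbers $1,2,\dots,n$ has already been assigned a $\Pi$-value. -}

module Defs where

open import Data.Nat using (ℕ; zero; suc; _+_; _∸_; _/_; _≟_)
open import Data.Maybe using (Maybe; just; nothing)
open import Relation.Nullary using (yes; no)

PMap : Set
PMap = ℕ → Maybe ℕ

empty : PMap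
empty _ = nothing

assign : ℕ → ℕ → PMap → PMap
assign p v f x with x ≟ p
... | yes _ = just v
... | no  _ = f x

step : ℕ → PMap → PMap
step m f with f (m ∸ (m / 2))
... | nothing = assign (m ∸ (m / 2)) m f
... | just _  = assign (m + (m / 2)) m f

Π-after : ℕ → PMap
Π-after zero          = empty
Π-after (suc zero)    = assign 1 1 empty
Π-after (suc (suc k)) = step (suc (suc k)) (Π-after (suc k))

-- Two observations suffice.
--   * Assignments are never revoked: each step only adds a value at one
--     position (or overwrites an existing one), so the set of assigned
--     positions grows with the number of steps carried out.
--   * Step 2k+1 always leaves position k+1 assigned, since for the odd
--     number m = 2k+1 we have m - ⌊m/2⌋ = k+1: either that position was
--     free and step m fills it, or it was assigned already.
-- Hence position k (for 1 ≤ k) is assigned after step 2k-1 (step 1 handles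
-- k = 1), and for k ≤ n it stays assigned through step 2n-1.
module Submission where

open import Defs
open import Data.Nat using (ℕ; _≤_; _∸_; _*_; zero; suc; _+_; _/_; _≟_; _≤′_; ≤′-refl; ≤′-step)
open import Data.Nat.Properties
  using (≤⇒≤′; +-suc; +-identityʳ; *-comm; *-monoʳ-≤; ∸-monoˡ-≤; m+n∸m≡n)
open import Data.Nat.DivMod using (+-distrib-/-∣ʳ; m*n/n≡m)
open import Data.Nat.Divisibility using (divides-refl)
open import Data.Maybe using (Is-just; just; nothing)
open import Data.Maybe.Relation.Unary.Any using (just)
open import Data.Unit using (tt)
open import Relation.Nullary using (yes; no)
open import Relation.Binary.PropositionalEquality
  using (_≡_; refl; sym; trans; cong; subst; module ≡-Reasoning)
open import Data.Empty using (⊥-elim)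
open import Function using (_∘_)

_⊑_ : PMap → PMap → Set
f ⊑ g = ∀ x → Is-just (f x) → Is-just (g x)

⊑-trans : ∀ {f g h} → f ⊑ g → g ⊑ h → f ⊑ h
⊑-trans f⊑g g⊑h x = g⊑h x ∘ f⊑g x

assign-extends : ∀ p v f → f ⊑ assign p v f
assign-extends p v f x assigned with x ≟ p
... | yes _ = just tt
... | no  _ = assigned

assign-target : ∀ p v f → Is-just (assign p v f p)
assign-target p v f with p ≟ p
... | yes _   = just tt
... | no  p≢p = ⊥-elim (p≢p refl)

step-extends : ∀ m f → f ⊑ step m f
step-extends m f with f (m ∸ m / 2)
... | nothing = assign-extends _ m f
... | just _  = assign-extends _ m f

-- … and afterwards the position m - ⌊m/2⌋ is assigned, whichever branch
-- was taken: either it is filled now or it was filled before.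
step-covers : ∀ m f → Is-just (step m f (m ∸ m / 2))
step-covers m f with f (m ∸ m / 2) in eq
... | nothing = assign-target (m ∸ m / 2) m f
... | just _  = assign-extends _ m f _ (subst Is-just (sym eq) (just tt))

Π-after-suc : ∀ i → Π-after i ⊑ Π-after (suc i)
Π-after-suc zero    x ()
Π-after-suc (suc i) = step-extends (suc (suc i)) (Π-after (suc i))

Π-after-mono : ∀ {i j} → i ≤′ j → Π-after i ⊑ Π-after j
Π-after-mono ≤′-refl           = λ _ assigned → assigned
Π-after-mono (≤′-step {j} i≤j) = ⊑-trans (Π-after-mono i≤j) (Π-after-suc j)

odd-half : ∀ j → suc (j * 2) / 2 ≡ j
odd-half j = trans (+-distrib-/-∣ʳ 1 {j * 2} (divides-refl j)) (m*n/n≡m j 2)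

odd-target : ∀ j → suc (j * 2) ∸ suc (j * 2) / 2 ≡ suc j
odd-target j = begin
  suc (j * 2) ∸ suc (j * 2) / 2 ≡⟨ cong (suc (j * 2) ∸_) (odd-half j) ⟩
  suc (j * 2) ∸ j               ≡⟨ cong (λ t → suc t ∸ j) (*-comm j 2) ⟩
  suc (j + (j + 0)) ∸ j         ≡⟨ cong (λ t → suc (j + t) ∸ j) (+-identityʳ j) ⟩
  suc (j + j) ∸ j               ≡⟨ sym (cong (_∸ j) (+-suc j j)) ⟩
  j + suc j ∸ j                 ≡⟨ m+n∸m≡n j (suc j) ⟩
  suc j                         ∎
  where open ≡-Reasoning

double-pred : ∀ j → 2 * suc j ∸ 1 ≡ suc (j * 2)
double-pred j = cong (_∸ 1) (*-comm 2 (suc j))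

assigned-at-odd-step : ∀ j → Is-just (Π-after (suc (j * 2)) (suc j))
assigned-at-odd-step zero    = just tt
assigned-at-odd-step (suc j) =
  subst (λ x → Is-just (Π-after (suc (suc j * 2)) x)) (odd-target (suc j))
        (step-covers (suc (suc j * 2)) (Π-after (suc j * 2)))

lemma1 : (n : ℕ) → 1 ≤ n → (k : ℕ) → 1 ≤ k → k ≤ n →
    Is-just (Π-after ((2 * n) ∸ 1) k)
lemma1 n _ (suc j) _ k≤n =
  Π-after-mono (≤⇒≤′ steps-suffice) (suc j) assigned-early
  where
  assigned-early : Is-just (Π-after (2 * suc j ∸ 1) (suc j))
  assigned-early = subst (λ i → Is-just (Π-after i (suc j)))
                         (sym (double-pred j)) (assigned-at-odd-step j)

  steps-suffice : 2 * suc j ∸ 1 ≤ 2 * n ∸ 1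
  steps-suffice = ∸-monoˡ-≤ 1 (*-monoʳ-≤ 2 k≤n)
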